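{- Let $n$ be a positive integer with binary representation $n = \sum_{k \ge 0} a_k 2^k$ (each $a_k \in \{0,1\}$, all but finitely many zero), and let $i \in \{1,3,5,7\}$. Then $$A_i(n) \equiv \sum_{k \ge 0} a_{k+3} + \#\Big\{k \ge 0 : \sum_{j=k}^{k+2} 2^{j-k} a_j \ge i\Big\} \pmod 2.$$
   Context: For positive integers $n$ and $x$ with $x \le n$, let $A(n,x) := \max\{k \ge 0 : 2^k x \le n\} + 1$. For $i \in \{1,3,5,7\}$, $A_i(n) := \sum_{1 \le x \le n,\ x \equiv i \pmod 8} A(n,x)$. -}

module Defs where

open import Data.Nat using (ℕ; zero; suc; _+_; _*_; _^_; _≤?_; _≟_)
open import Data.Nat.DivMod using (_/_; _%_)
open import Data.Nat.ListAction using (sum)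
open import Data.List using (List; map; filter; length; upTo; applyUpTo)
open import Data.Bool using (if_then_else_)
open import Relation.Nullary.Decidable using (⌊_⌋)

digit : ℕ → ℕ → ℕ
digit n zero    = n % 2
digit n (suc k) = digit (n / 2) k

-- Greatest k ≤ N with 2^k * x ≤ n (returns 0 if none).
greatestExp : ℕ → ℕ → ℕ → ℕ
greatestExp n x zero    = 0
greatestExp n x (suc N) =
  if ⌊ 2 ^ suc N * x ≤? n ⌋ then suc N else greatestExp n x N

-- A(n,x) = max{k ≥ 0 : 2^k x ≤ n} + 1.  For 1 ≤ x ≤ n every such k satisfies
-- k < 2^k ≤ 2^k x ≤ n, so searching k ∈ [0,n] finds the maximum.
A : ℕ → ℕ → ℕ
A n x = greatestExp n x n + 1

Ai : ℕ → ℕ → ℕ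
Ai i n = sum (map (A n) (filter (λ x → x % 8 ≟ i) (applyUpTo suc n)))

window : ℕ → ℕ → ℕ
window n k = digit n k + 2 * digit n (k + 1) + 4 * digit n (k + 2)

-- Σ_{k ≥ 0} a_{k+3}; digits a_j vanish for j ≥ n (2^j > n), so k < n suffices.
digitSumFrom3 : ℕ → ℕ
digitSumFrom3 n = sum (map (λ k → digit n (k + 3)) (upTo n))

-- #{k ≥ 0 : window n k ≥ i}; for i ≥ 1 the window is 0 once k ≥ n.
windowCount : ℕ → ℕ → ℕ
windowCount i n = length (filter (λ k → i ≤? window n k) (upTo n))

{-# OPTIONS --safe #-}
module Submission where

-- Counting the pairs (x, k) with x ≡ i (mod 8) and 2^k x ≤ n by k instead of by x,
-- A_i(n) = Σ_k #{1 ≤ x ≤ ⌊n/2^k⌋ : x ≡ i (mod 8)} = Σ_k (⌊n/2^(k+3)⌋ + [⌊n/2^k⌋ mod 8 ≥ i]).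
-- Modulo 2, ⌊n/2^(k+3)⌋ is the digit a_{k+3}, and ⌊n/2^k⌋ mod 8 is the window at k.
-- Below, n >> k is ⌊n/2^k⌋ and 𝟙 is the Iverson bracket.

open import Defs
open import Data.Nat using (ℕ; zero; suc; pred; _+_; _*_; _∸_; _^_; _≤_; _<_; z≤n; s≤s; _≤?_; _<?_; _≟_; NonZero)
open import Data.Nat.Properties
open import Data.Nat.DivMod
open import Data.Nat.ListAction using (sum)
open import Data.List using (map; filter; length; applyUpTo)
open import Data.Sum using (inj₁; inj₂; _⊎_)
open import Data.Empty using (⊥-elim)
open import Relation.Nullary using (Dec; yes; no; ¬_)
open import Relation.Nullary.Decidable using (from-yes)
open import Relation.Unary using (Pred; Decidable)
open import Relation.Binary.PropositionalEquality
open import Function using (_∘_; _⇔_; mk⇔; Equivalence)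
open import Data.Nat.Tactic.RingSolver using (solve-∀)

open Equivalence using (to; from)

∑< : ℕ → (ℕ → ℕ) → ℕ
∑< zero    f = 0
∑< (suc n) f = f 0 + ∑< n (f ∘ suc)

syntax ∑< n (λ k → e) = ∑[ k < n ] e

∑<-cong : ∀ n {f g : ℕ → ℕ} → (∀ j → j < n → f j ≡ g j) → ∑< n f ≡ ∑< n g
∑<-cong zero    eq = refl
∑<-cong (suc n) eq = cong₂ _+_ (eq 0 (s≤s z≤n)) (∑<-cong n (λ j j<n → eq (suc j) (s≤s j<n)))

∑<-zero : ∀ n → ∑[ _ < n ] 0 ≡ 0
∑<-zero zero    = refl
∑<-zero (suc n) = ∑<-zero n

∑<-distrib-+ : ∀ n (f g : ℕ → ℕ) → ∑[ j < n ] (f j + g j) ≡ ∑< n f + ∑< n g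
∑<-distrib-+ zero    f g = refl
∑<-distrib-+ (suc n) f g rewrite ∑<-distrib-+ n (f ∘ suc) (g ∘ suc) =
  interchange (f 0) (g 0) (∑< n (f ∘ suc)) (∑< n (g ∘ suc))
  where
  interchange : ∀ a b c d → a + b + (c + d) ≡ a + c + (b + d)
  interchange = solve-∀

*-distribˡ-∑< : ∀ n c (f : ℕ → ℕ) → c * ∑< n f ≡ ∑[ j < n ] (c * f j)
*-distribˡ-∑< zero    c f = *-zeroʳ c
*-distribˡ-∑< (suc n) c f =
  trans (*-distribˡ-+ c (f 0) (∑< n (f ∘ suc))) (cong (c * f 0 +_) (*-distribˡ-∑< n c (f ∘ suc)))

∑<-comm : ∀ n m (f : ℕ → ℕ → ℕ) → ∑[ x < n ] ∑< m (f x) ≡ ∑[ k < m ] ∑[ x < n ] f x k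
∑<-comm zero    m f = sym (∑<-zero m)
∑<-comm (suc n) m f rewrite ∑<-comm n m (f ∘ suc) =
  sym (∑<-distrib-+ m (f 0) (λ k → ∑[ x < n ] f (suc x) k))

∑<-suc : ∀ n (f : ℕ → ℕ) → ∑< (suc n) f ≡ ∑< n f + f n
∑<-suc zero    f = +-comm (f 0) 0
∑<-suc (suc n) f rewrite ∑<-suc n (f ∘ suc) = sym (+-assoc (f 0) (∑< n (f ∘ suc)) (f (suc n)))

∑<-+ : ∀ a b (f : ℕ → ℕ) → ∑< (a + b) f ≡ ∑< a f + ∑[ j < b ] f (a + j)
∑<-+ zero    b f = refl
∑<-+ (suc a) b f rewrite ∑<-+ a b (f ∘ suc) = sym (+-assoc (f 0) (∑< a (f ∘ suc)) _)

∑<-suc-last≡0 : ∀ n (f : ℕ → ℕ) → f n ≡ 0 → ∑< (suc n) f ≡ ∑< n f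
∑<-suc-last≡0 n f fn≡0 = trans (∑<-suc n f) (trans (cong (∑< n f +_) fn≡0) (+-identityʳ _))

%-cong-+ : ∀ {a b c e} d .{{_ : NonZero d}} → a % d ≡ b % d → c % d ≡ e % d → (a + c) % d ≡ (b + e) % d
%-cong-+ {a} {b} {c} {e} d a≡b c≡e = begin
  (a + c) % d             ≡⟨ %-distribˡ-+ a c d ⟩
  (a % d + c % d) % d     ≡⟨ cong₂ (λ x y → (x + y) % d) a≡b c≡e ⟩
  (b % d + e % d) % d     ≡⟨ %-distribˡ-+ b e d ⟨
  (b + e) % d             ∎
  where open ≡-Reasoning

∑<-cong-% : ∀ d .{{_ : NonZero d}} n (f g : ℕ → ℕ) →
            (∀ k → f k % d ≡ g k % d) → ∑< n f % d ≡ ∑< n g % d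
∑<-cong-% d zero    f g eq = refl
∑<-cong-% d (suc n) f g eq = %-cong-+ d (eq 0) (∑<-cong-% d n (f ∘ suc) (g ∘ suc) (eq ∘ suc))

𝟙 : ∀ {p} {P : Set p} → Dec P → ℕ
𝟙 (yes _) = 1
𝟙 (no _)  = 0

𝟙-yes : ∀ {p} {P : Set p} (P? : Dec P) → P → 𝟙 P? ≡ 1
𝟙-yes (yes _) _  = refl
𝟙-yes (no ¬p) p  = ⊥-elim (¬p p)

𝟙-no : ∀ {p} {P : Set p} (P? : Dec P) → ¬ P → 𝟙 P? ≡ 0
𝟙-no (yes p) ¬p = ⊥-elim (¬p p)
𝟙-no (no _)  _  = refl

𝟙-cong : ∀ {p q} {P : Set p} {Q : Set q} (P? : Dec P) (Q? : Dec Q) → P ⇔ Q → 𝟙 P? ≡ 𝟙 Q?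
𝟙-cong (yes p) (yes q) P⇔Q = refl
𝟙-cong (yes p) (no ¬q) P⇔Q = ⊥-elim (¬q (to P⇔Q p))
𝟙-cong (no ¬p) (yes q) P⇔Q = ⊥-elim (¬p (from P⇔Q q))
𝟙-cong (no _)  (no _)  P⇔Q = refl

𝟙-≤-suc : ∀ i r → 𝟙 (i ≤? suc r) ≡ 𝟙 (i ≤? r) + 𝟙 (suc r ≟ i)
𝟙-≤-suc i r with i ≤? r | suc r ≟ i
... | yes i≤r | yes refl = ⊥-elim (<-irrefl refl i≤r)
... | yes i≤r | no  _    = 𝟙-yes (i ≤? suc r) (m≤n⇒m≤1+n i≤r)
... | no  _   | yes refl = 𝟙-yes (suc r ≤? suc r) ≤-refl
... | no  i≰r | no  r+1≢i = 𝟙-no (i ≤? suc r) i≰r+1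
  where
  i≰r+1 : ¬ i ≤ suc r
  i≰r+1 i≤r+1 with m≤n⇒m<n∨m≡n i≤r+1
  ... | inj₁ i<r+1 = i≰r (≤-pred i<r+1)
  ... | inj₂ i≡r+1 = r+1≢i (sym i≡r+1)

∑<-truncate : ∀ m n (g : ℕ → ℕ) → m ≤ n → ∑[ j < n ] (g j * 𝟙 (j <? m)) ≡ ∑< m g
∑<-truncate m n g m≤n = begin
  ∑< n F                              ≡⟨ cong (λ v → ∑< v F) (m+[n∸m]≡n m≤n) ⟨
  ∑< (m + (n ∸ m)) F                  ≡⟨ ∑<-+ m (n ∸ m) F ⟩
  ∑< m F + ∑[ j < n ∸ m ] F (m + j)   ≡⟨ cong₂ _+_ (∑<-cong m below) (trans (∑<-cong (n ∸ m) above) (∑<-zero (n ∸ m))) ⟩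
  ∑< m g + 0                          ≡⟨ +-identityʳ _ ⟩
  ∑< m g                              ∎
  where
  open ≡-Reasoning
  F = λ j → g j * 𝟙 (j <? m)
  below : ∀ j → j < m → F j ≡ g j
  below j j<m = trans (cong (g j *_) (𝟙-yes (j <? m) j<m)) (*-identityʳ (g j))
  above : ∀ j → j < n ∸ m → F (m + j) ≡ 0
  above j _ = trans (cong (g (m + j) *_) (𝟙-no (m + j <? m) (m+n≮m m j))) (*-zeroʳ (g (m + j)))

sum-map-filter-applyUpTo : ∀ {ℓ} {P : Pred ℕ ℓ} (P? : Decidable P) (f g : ℕ → ℕ) n →
  sum (map f (filter P? (applyUpTo g n))) ≡ ∑[ j < n ] (𝟙 (P? (g j)) * f (g j))
sum-map-filter-applyUpTo P? f g zero = refl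
sum-map-filter-applyUpTo P? f g (suc n) with P? (g 0)
... | yes _ = cong₂ _+_ (sym (+-identityʳ (f (g 0)))) (sum-map-filter-applyUpTo P? f (g ∘ suc) n)
... | no  _ = sum-map-filter-applyUpTo P? f (g ∘ suc) n

length-filter-applyUpTo : ∀ {ℓ} {P : Pred ℕ ℓ} (P? : Decidable P) (g : ℕ → ℕ) n →
  length (filter P? (applyUpTo g n)) ≡ ∑[ j < n ] 𝟙 (P? (g j))
length-filter-applyUpTo P? g zero = refl
length-filter-applyUpTo P? g (suc n) with P? (g 0)
... | yes _ = cong suc (length-filter-applyUpTo P? (g ∘ suc) n)
... | no  _ = length-filter-applyUpTo P? (g ∘ suc) n

sum-map-applyUpTo : ∀ (f g : ℕ → ℕ) n → sum (map f (applyUpTo g n)) ≡ ∑< n (f ∘ g)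
sum-map-applyUpTo f g zero    = refl
sum-map-applyUpTo f g (suc n) = cong (f (g 0) +_) (sum-map-applyUpTo f (g ∘ suc) n)

infixl 8 _>>_

_>>_ : ℕ → ℕ → ℕ
n >> zero  = n
n >> suc k = (n / 2) >> k

digit-+ : ∀ n k j → digit n (k + j) ≡ digit (n >> k) j
digit-+ n zero    j = refl
digit-+ n (suc k) j = digit-+ (n / 2) k j

>>-≤ : ∀ n k → n >> k ≤ n
>>-≤ n zero    = ≤-refl
>>-≤ n (suc k) = ≤-trans (>>-≤ (n / 2) k) (m/n≤m n 2)

n<2^k⇒n>>k≡0 : ∀ n k → n < 2 ^ k → n >> k ≡ 0
n<2^k⇒n>>k≡0 n zero    n<1   = n≤0⇒n≡0 (≤-pred n<1)
n<2^k⇒n>>k≡0 n (suc k) n<2^k = n<2^k⇒n>>k≡0 (n / 2) k (m<n*o⇒m/o<n (subst (n <_) (*-comm 2 (2 ^ k)) n<2^k))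

n<2^n : ∀ n → n < 2 ^ n
n<2^n zero    = s≤s z≤n
n<2^n (suc n) = subst (_≤ 2 ^ n + (2 ^ n + 0)) (+-comm (suc n) 1)
  (+-mono-≤ (n<2^n n) (≤-trans (m^n>0 2 n) (m≤m+n (2 ^ n) 0)))

2*m≤n⇔m≤n/2 : ∀ m n → 2 * m ≤ n ⇔ m ≤ n / 2
2*m≤n⇔m≤n/2 m n = mk⇔
  (λ 2m≤n → subst (_≤ n / 2) (m*n/n≡m m 2) (/-monoˡ-≤ 2 (subst (_≤ n) (*-comm 2 m) 2m≤n)))
  (λ m≤n/2 → ≤-trans (*-monoʳ-≤ 2 m≤n/2) (subst (_≤ n) (*-comm (n / 2) 2) (m/n*n≤m n 2)))

2^k*m≤n⇔m≤n>>k : ∀ k m n → 2 ^ k * m ≤ n ⇔ m ≤ n >> k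
2^k*m≤n⇔m≤n>>k zero    m n = mk⇔ (subst (_≤ n) (*-identityˡ m)) (subst (_≤ n) (sym (*-identityˡ m)))
2^k*m≤n⇔m≤n>>k (suc k) m n = mk⇔
  (λ h → to (2^k*m≤n⇔m≤n>>k k m (n / 2))
             (to (2*m≤n⇔m≤n/2 (2 ^ k * m) n) (subst (_≤ n) (*-assoc 2 (2 ^ k) m) h)))
  (λ h → subst (_≤ n) (sym (*-assoc 2 (2 ^ k) m))
             (from (2*m≤n⇔m≤n/2 (2 ^ k * m) n) (from (2^k*m≤n⇔m≤n>>k k m (n / 2)) h)))

∑<-one : ∀ n → ∑[ _ < n ] 1 ≡ n
∑<-one zero    = refl
∑<-one (suc n) = cong suc (∑<-one n)

greatestExp≡count : ∀ n x N → x ≤ n → greatestExp n x N + 1 ≡ ∑[ k < suc N ] 𝟙 (2 ^ k * x ≤? n)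
greatestExp≡count n x zero x≤n =
  cong (_+ 0) (sym (𝟙-yes (2 ^ 0 * x ≤? n) (from (2^k*m≤n⇔m≤n>>k 0 x n) x≤n)))
greatestExp≡count n x (suc N) x≤n rewrite ∑<-suc (suc N) (λ k → 𝟙 (2 ^ k * x ≤? n))
  with 2 ^ suc N * x ≤? n
... | yes 2^N+1*x≤n = cong (_+ 1) (sym (trans (∑<-cong (suc N) below-N+1) (∑<-one (suc N))))
  where
  below-N+1 : ∀ k → k < suc N → 𝟙 (2 ^ k * x ≤? n) ≡ 1
  below-N+1 k k<N+1 = 𝟙-yes (2 ^ k * x ≤? n)
    (≤-trans (*-monoˡ-≤ x (^-monoʳ-≤ 2 (<⇒≤ k<N+1))) 2^N+1*x≤n)
... | no _ = trans (greatestExp≡count n x N x≤n) (sym (+-identityʳ _))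

A≡count : ∀ n x → x ≤ n → A n x ≡ ∑[ k < suc n ] 𝟙 (x ≤? n >> k)
A≡count n x x≤n = trans (greatestExp≡count n x n x≤n)
  (∑<-cong (suc n) (λ k _ → 𝟙-cong (2 ^ k * x ≤? n) (x ≤? n >> k) (2^k*m≤n⇔m≤n>>k k x n)))

module _ (d : ℕ) .{{_ : NonZero d}} (i : ℕ) (1≤i : 1 ≤ i) where

  ∑-residue-initial : ∀ r → r < d → ∑[ j < r ] 𝟙 (suc j % d ≟ i) ≡ 𝟙 (i ≤? r)
  ∑-residue-initial zero    _     = sym (𝟙-no (i ≤? 0) (λ i≤0 → <-irrefl refl (≤-trans 1≤i i≤0)))
  ∑-residue-initial (suc r) r+1<d = begin
    ∑[ j < suc r ] 𝟙 (suc j % d ≟ i)             ≡⟨ ∑<-suc r (λ j → 𝟙 (suc j % d ≟ i)) ⟩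
    ∑[ j < r ] 𝟙 (suc j % d ≟ i) + 𝟙 (suc r % d ≟ i) ≡⟨ cong₂ _+_ (∑-residue-initial r (<⇒≤ r+1<d))
                                                       (cong (λ v → 𝟙 (v ≟ i)) (m<n⇒m%n≡m r+1<d)) ⟩
    𝟙 (i ≤? r) + 𝟙 (suc r ≟ i)                   ≡⟨ 𝟙-≤-suc i r ⟨
    𝟙 (i ≤? suc r)                               ∎
    where open ≡-Reasoning

  𝟙-residue-periodic : ∀ q j → 𝟙 (suc (q * d + j) % d ≟ i) ≡ 𝟙 (suc j % d ≟ i)
  𝟙-residue-periodic q j = trans
    (cong (λ v → 𝟙 (v % d ≟ i)) (trans (sym (+-suc (q * d) j)) (+-comm (q * d) (suc j))))
    (cong (λ v → 𝟙 (v ≟ i)) ([m+kn]%n≡m%n (suc j) q d))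

  module _ (i<d : i < d) where

    ∑-residue-period : ∑[ j < d ] 𝟙 (suc j % d ≟ i) ≡ 1
    ∑-residue-period = begin
      ∑< d f                        ≡⟨ cong (λ m → ∑< m f) (sym (suc-pred d)) ⟩
      ∑< (suc e) f                  ≡⟨ ∑<-suc e f ⟩
      ∑< e f + 𝟙 (suc e % d ≟ i)    ≡⟨ cong₂ _+_ (∑-residue-initial e e<d)
                                         (cong (λ v → 𝟙 (v % d ≟ i)) (suc-pred d)) ⟩
      𝟙 (i ≤? e) + 𝟙 (d % d ≟ i)    ≡⟨ cong₂ _+_ (𝟙-yes (i ≤? e) (≤-pred (subst (i <_) (sym (suc-pred d)) i<d)))
                                         (trans (cong (λ v → 𝟙 (v ≟ i)) (n%n≡0 d))
                                                (𝟙-no (0 ≟ i) (λ 0≡i → <-irrefl 0≡i 1≤i))) ⟩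
      1                             ∎
      where
      open ≡-Reasoning
      f = λ j → 𝟙 (suc j % d ≟ i)
      e = pred d
      e<d : e < d
      e<d = subst (e <_) (suc-pred d) ≤-refl

    ∑-residue-periods : ∀ q → ∑[ j < q * d ] 𝟙 (suc j % d ≟ i) ≡ q
    ∑-residue-periods zero    = refl
    ∑-residue-periods (suc q) = begin
      ∑< (d + q * d) f                   ≡⟨ cong (λ m → ∑< m f) (+-comm d (q * d)) ⟩
      ∑< (q * d + d) f                   ≡⟨ ∑<-+ (q * d) d f ⟩
      ∑< (q * d) f + ∑[ j < d ] f (q * d + j)
        ≡⟨ cong₂ _+_ (∑-residue-periods q) (trans (∑<-cong d (λ j _ → 𝟙-residue-periodic q j)) ∑-residue-period) ⟩
      q + 1                              ≡⟨ +-comm q 1 ⟩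
      suc q                              ∎
      where
      open ≡-Reasoning
      f = λ j → 𝟙 (suc j % d ≟ i)

    ∑-residue : ∀ m → ∑[ j < m ] 𝟙 (suc j % d ≟ i) ≡ m / d + 𝟙 (i ≤? m % d)
    ∑-residue m = begin
      ∑< m f                                 ≡⟨ cong (λ v → ∑< v f) m≡qd+r ⟩
      ∑< (q * d + r) f                       ≡⟨ ∑<-+ (q * d) r f ⟩
      ∑< (q * d) f + ∑[ j < r ] f (q * d + j)
        ≡⟨ cong₂ _+_ (∑-residue-periods q)
             (trans (∑<-cong r (λ j _ → 𝟙-residue-periodic q j)) (∑-residue-initial r (m%n<n m d))) ⟩
      q + 𝟙 (i ≤? r)                         ∎
      where
      open ≡-Reasoning
      f = λ j → 𝟙 (suc j % d ≟ i)
      q = m / d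
      r = m % d
      m≡qd+r : m ≡ q * d + r
      m≡qd+r = trans (m≡m%n+[m/n]*n m d) (+-comm r (q * d))

m%[n*2]≡m/2%n*2+m%2 : ∀ m n .{{_ : NonZero n}} .{{_ : NonZero (n * 2)}} →
                      m % (n * 2) ≡ m / 2 % n * 2 + m % 2
m%[n*2]≡m/2%n*2+m%2 m n = begin
  m % (n * 2)                   ≡⟨ cong (_% (n * 2)) (trans (m≡m%n+[m/n]*n m 2) (+-comm (m % 2) _)) ⟩
  (m / 2 * 2 + m % 2) % (n * 2) ≡⟨ [m*n+o]%[p*n]≡[m*n]%[p*n]+o (m / 2) n (m%n<n m 2) ⟩
  m / 2 * 2 % (n * 2) + m % 2   ≡⟨ cong (_+ m % 2) (m%n*o≡m*o%[n*o] (m / 2) n 2) ⟨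
  m / 2 % n * 2 + m % 2         ∎
  where open ≡-Reasoning

m%8≡digits : ∀ m → m % 8 ≡ digit m 0 + 2 * digit m 1 + 4 * digit m 2
m%8≡digits m = begin
  m % 8                                        ≡⟨ m%[n*2]≡m/2%n*2+m%2 m 4 ⟩
  m / 2 % 4 * 2 + m % 2                        ≡⟨ cong (λ v → v * 2 + m % 2) (m%[n*2]≡m/2%n*2+m%2 (m / 2) 2) ⟩
  (m / 2 / 2 % 2 * 2 + m / 2 % 2) * 2 + m % 2  ≡⟨ reorder (m % 2) (m / 2 % 2) (m / 2 / 2 % 2) ⟩
  m % 2 + 2 * (m / 2 % 2) + 4 * (m / 2 / 2 % 2) ∎
  where
  open ≡-Reasoning
  reorder : ∀ a b c → (c * 2 + b) * 2 + a ≡ a + 2 * b + 4 * c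
  reorder = solve-∀

window≡>>%8 : ∀ n k → window n k ≡ n >> k % 8
window≡>>%8 n k = begin
  digit n k + 2 * digit n (k + 1) + 4 * digit n (k + 2)
    ≡⟨ cong₂ _+_ (cong₂ _+_ (trans (cong (digit n) (sym (+-identityʳ k))) (digit-+ n k 0))
                            (cong (2 *_) (digit-+ n k 1)))
                 (cong (4 *_) (digit-+ n k 2)) ⟩
  digit (n >> k) 0 + 2 * digit (n >> k) 1 + 4 * digit (n >> k) 2
    ≡⟨ m%8≡digits (n >> k) ⟨
  n >> k % 8 ∎
  where open ≡-Reasoning

digit-+3≡>>/8%2 : ∀ n k → digit n (k + 3) ≡ n >> k / 8 % 2
digit-+3≡>>/8%2 n k = trans (digit-+ n k 3)
  (cong (_% 2) (trans (cong (_/ 2) (m/n/o≡m/[n*o] m 2 2)) (m/n/o≡m/[n*o] m 4 2)))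
  where m = n >> k

Ai≡∑-residue : ∀ i n → Ai i n ≡ ∑[ k < suc n ] ∑[ j < n >> k ] 𝟙 (suc j % 8 ≟ i)
Ai≡∑-residue i n = begin
  Ai i n
    ≡⟨ sum-map-filter-applyUpTo (λ x → x % 8 ≟ i) (A n) suc n ⟩
  ∑[ j < n ] (r j * A n (suc j))
    ≡⟨ ∑<-cong n (λ j j<n → cong (r j *_) (A≡count n (suc j) j<n)) ⟩
  ∑[ j < n ] (r j * ∑[ k < suc n ] 𝟙 (j <? n >> k))
    ≡⟨ ∑<-cong n (λ j _ → *-distribˡ-∑< (suc n) (r j) (λ k → 𝟙 (j <? n >> k))) ⟩
  ∑[ j < n ] ∑[ k < suc n ] (r j * 𝟙 (j <? n >> k))
    ≡⟨ ∑<-comm n (suc n) (λ j k → r j * 𝟙 (j <? n >> k)) ⟩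
  ∑[ k < suc n ] ∑[ j < n ] (r j * 𝟙 (j <? n >> k))
    ≡⟨ ∑<-cong (suc n) (λ k _ → ∑<-truncate (n >> k) n r (>>-≤ n k)) ⟩
  ∑[ k < suc n ] ∑[ j < n >> k ] r j ∎
  where
  open ≡-Reasoning
  r = λ j → 𝟙 (suc j % 8 ≟ i)

windowCount≡∑ : ∀ i n → windowCount i n ≡ ∑[ k < n ] 𝟙 (i ≤? n >> k % 8)
windowCount≡∑ i n = trans (length-filter-applyUpTo (λ k → i ≤? window n k) (λ k → k) n)
  (∑<-cong n (λ k _ → cong (λ v → 𝟙 (i ≤? v)) (window≡>>%8 n k)))

digitSumFrom3≡∑ : ∀ n → digitSumFrom3 n ≡ ∑[ k < n ] (n >> k / 8 % 2)
digitSumFrom3≡∑ n = trans (sum-map-applyUpTo (λ k → digit n (k + 3)) (λ k → k) n)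
  (∑<-cong n (λ k _ → digit-+3≡>>/8%2 n k))

Ai≡∑+windowCount : ∀ i n → 1 ≤ i → i < 8 → Ai i n ≡ ∑[ k < n ] (n >> k / 8) + windowCount i n
Ai≡∑+windowCount i n 1≤i i<8 = begin
  Ai i n                                                 ≡⟨ Ai≡∑-residue i n ⟩
  ∑[ k < suc n ] ∑[ j < n >> k ] 𝟙 (suc j % 8 ≟ i)       ≡⟨ ∑<-cong (suc n) (λ k _ → ∑-residue 8 i 1≤i i<8 (n >> k)) ⟩
  ∑[ k < suc n ] (n >> k / 8 + 𝟙 (i ≤? n >> k % 8))      ≡⟨ ∑<-suc-last≡0 n _ last≡0 ⟩
  ∑[ k < n ] (n >> k / 8 + 𝟙 (i ≤? n >> k % 8))          ≡⟨ ∑<-distrib-+ n (λ k → n >> k / 8) (λ k → 𝟙 (i ≤? n >> k % 8)) ⟩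
  ∑[ k < n ] (n >> k / 8) + ∑[ k < n ] 𝟙 (i ≤? n >> k % 8) ≡⟨ cong (_ +_) (windowCount≡∑ i n) ⟨
  ∑[ k < n ] (n >> k / 8) + windowCount i n              ∎
  where
  open ≡-Reasoning
  last≡0 : n >> n / 8 + 𝟙 (i ≤? n >> n % 8) ≡ 0
  last≡0 rewrite n<2^k⇒n>>k≡0 n n (n<2^n n) = 𝟙-no (i ≤? 0) (λ i≤0 → <-irrefl refl (≤-trans 1≤i i≤0))

Ai-parity : ∀ i n → 1 ≤ i → i < 8 → Ai i n % 2 ≡ (digitSumFrom3 n + windowCount i n) % 2
Ai-parity i n 1≤i i<8 = begin
  Ai i n % 2                          ≡⟨ cong (_% 2) (Ai≡∑+windowCount i n 1≤i i<8) ⟩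
  (∑< n q + windowCount i n) % 2      ≡⟨ %-cong-+ {∑< n q} {∑< n q%2} {windowCount i n} {windowCount i n} 2
                                           (∑<-cong-% 2 n q q%2 (λ k → sym (m%n%n≡m%n (q k) 2))) refl ⟩
  (∑< n q%2 + windowCount i n) % 2    ≡⟨ cong (λ v → (v + windowCount i n) % 2) (digitSumFrom3≡∑ n) ⟨
  (digitSumFrom3 n + windowCount i n) % 2 ∎
  where
  open ≡-Reasoning
  q q%2 : ℕ → ℕ
  q k = n >> k / 8
  q%2 k = n >> k / 8 % 2

corollary7 : (n i : ℕ) → 1 ≤ n → (i ≡ 1 ⊎ i ≡ 3 ⊎ i ≡ 5 ⊎ i ≡ 7) →
    Ai i n % 2 ≡ (digitSumFrom3 n + windowCount i n) % 2
corollary7 n .1 _ (inj₁ refl)                = Ai-parity 1 n (from-yes (1 ≤? 1)) (from-yes (1 <? 8))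
corollary7 n .3 _ (inj₂ (inj₁ refl))         = Ai-parity 3 n (from-yes (1 ≤? 3)) (from-yes (3 <? 8))
corollary7 n .5 _ (inj₂ (inj₂ (inj₁ refl)))  = Ai-parity 5 n (from-yes (1 ≤? 5)) (from-yes (5 <? 8))
corollary7 n .7 _ (inj₂ (inj₂ (inj₂ refl)))  = Ai-parity 7 n (from-yes (1 ≤? 7)) (from-yes (7 <? 8))
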